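{- Let $\Gamma$ be a finite connected digraph, $G\le\mathrm{Aut}(\Gamma)$, and suppose $\Gamma$ is $G$-vertex-transitive and $(G,s)$-arc-transitive with $s\ge1$. Let $N\le G$ with $|V_N|\ge3$. Then $\Gamma_N$ is connected, and moreover: (a) if $N\trianglelefteq G$ and $s\ge2$, then $\Gamma_N$ is a digraph and is $G/N$-vertex-transitive and $(G/N,s)$-arc-transitive; (b) if $N\trianglelefteq M\trianglelefteq G$ and $s\ge3$, with $N$ not normal in $G$ and $M$ vertex-transitive on $\Gamma$, then $\Gamma_N$ is a digraph and is $N_G(N)/N$-vertex-transitive and $(N_G(N)/N,s-1)$-arc-transitive.
   Context: A digraph $\Gamma$ consists of a finite vertex set $V\Gamma$ and arc set $A\Gamma\subseteq V\Gamma\times V\Gamma$ such that $(u,v)\in A\Gamma$ implies $(v,u)\notin A\Gamma$ (no loops, no pairs of opposite arcs). An $s$-arc is a sequence $(v_0,\dots,v_s)$ with $(v_i,v_{i+1})\in A\Gamma$ for all $i$; $(G,s)$-arc-transitive means $G$ is transitive on $s$-arcs. Connectedness refers to the underlying undirected graph. For $N\le\mathrm{Aut}(\Gamma)$, $V_N$ is the set of $N$-orbits on $V\Gamma$, and the quotient $\Gamma_N$ has vertex set $V_N$ and arcs all pairs $(U,U')\in V_N\times V_N$ such that $(u,u')\in A\Gamma$ for some $u\in U$, $u'\in U'$. Groups such as $G/N$ or $N_G(N)/N$ act on $V_N$ in the natural way. -}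

module Defs where

open import Data.Nat using (ℕ)
open import Data.Fin using (Fin; inject₁; suc)
open import Data.Fin.Permutation using (Permutation′; _⟨$⟩ʳ_; _∘ₚ_; flip; id)
open import Data.Product using (Σ; ∃; _×_; _,_)
open import Data.Sum using (_⊎_)
open import Relation.Nullary using (¬_)
open import Relation.Binary.PropositionalEquality using (_≡_)
open import Relation.Binary.Construct.Closure.ReflexiveTransitive using (Star)

-- A finite digraph on vertex set Fin n: arc relation with no loops and
-- no pairs of opposite arcs (asymmetry with u = v excludes loops).
record Digraph (n : ℕ) : Set₁ where
  field
    Arc  : Fin n → Fin n → Set
    asym : ∀ {u v} → Arc u v → ¬ Arc v u
open Digraph public

Perm : ℕ → Set
Perm = Permutation′

PermSet : ℕ → Set₁
PermSet n = Perm n → Set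

record IsSubgroup {n : ℕ} (H : PermSet n) : Set where
  field
    ext  : ∀ σ τ → (∀ i → σ ⟨$⟩ʳ i ≡ τ ⟨$⟩ʳ i) → H σ → H τ
    one  : H id
    comp : ∀ σ τ → H σ → H τ → H (σ ∘ₚ τ)
    inv  : ∀ σ → H σ → H (flip σ)

IsAut : ∀ {n} → Digraph n → Perm n → Set
IsAut Γ σ = ∀ u v → (Arc Γ u v → Arc Γ (σ ⟨$⟩ʳ u) (σ ⟨$⟩ʳ v))
                  × (Arc Γ (σ ⟨$⟩ʳ u) (σ ⟨$⟩ʳ v) → Arc Γ u v)

IsAutGroup : ∀ {n} → Digraph n → PermSet n → Set
IsAutGroup Γ G = IsSubgroup G × (∀ g → G g → IsAut Γ g)

_≤G_ : ∀ {n} → PermSet n → PermSet n → Set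
H ≤G K = IsSubgroup H × (∀ h → H h → K h)

-- g h g⁻¹  (note: σ ∘ₚ τ applies σ first)
conj : ∀ {n} → Perm n → Perm n → Perm n
conj g h = flip g ∘ₚ h ∘ₚ g

Normal : ∀ {n} → PermSet n → PermSet n → Set
Normal N K = ∀ k h → K k → N h → N (conj k h)

Normaliser : ∀ {n} → PermSet n → PermSet n → PermSet n
Normaliser G N g = G g × (∀ h → N h → N (conj g h)) × (∀ h → N h → N (conj (flip g) h))

Connected : ∀ {n} → (Fin n → Fin n → Set) → Set
Connected {n} R = ∀ (u v : Fin n) → Star (λ x y → R x y ⊎ R y x) u v

VertexTransitive : ∀ {n} → PermSet n → Set
VertexTransitive {n} H = ∀ (u v : Fin n) → ∃ λ g → H g × g ⟨$⟩ʳ u ≡ v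

SArc : ∀ {n} → (Fin n → Fin n → Set) → (s : ℕ) → (Fin (ℕ.suc s) → Fin n) → Set
SArc R s f = ∀ (i : Fin s) → R (f (inject₁ i)) (f (suc i))

ArcTransitive : ∀ {n} → PermSet n → Digraph n → ℕ → Set
ArcTransitive H Γ s = ∀ f f' → SArc (Arc Γ) s f → SArc (Arc Γ) s f' →
  ∃ λ g → H g × (∀ i → g ⟨$⟩ʳ f i ≡ f' i)

-- Quotient by the orbits of N. An N-orbit (vertex of Γ_N) is represented
-- by any of its elements; two representatives denote the same vertex of
-- Γ_N iff they are in the same N-orbit.

SameOrbit : ∀ {n} → PermSet n → Fin n → Fin n → Set
SameOrbit N u v = ∃ λ x → N x × x ⟨$⟩ʳ u ≡ v

QArc : ∀ {n} → Digraph n → PermSet n → Fin n → Fin n → Set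
QArc Γ N U U' = ∃ λ u → ∃ λ u' → SameOrbit N U u × SameOrbit N U' u' × Arc Γ u u'

AtLeast3Orbits : ∀ {n} → PermSet n → Set
AtLeast3Orbits {n} N = ∃ λ (u : Fin n) → ∃ λ v → ∃ λ w →
  ¬ SameOrbit N u v × ¬ SameOrbit N u w × ¬ SameOrbit N v w

QIsDigraph : ∀ {n} → Digraph n → PermSet n → Set
QIsDigraph Γ N = (∀ U U' → SameOrbit N U U' → ¬ QArc Γ N U U')
               × (∀ U U' → QArc Γ N U U' → ¬ QArc Γ N U' U)

-- H (acting through H N/N on V_N via g·[u] = [g u]) is transitive on V_N
QVertexTransitive : ∀ {n} → PermSet n → PermSet n → Set
QVertexTransitive {n} H N = ∀ (U U' : Fin n) → ∃ λ g → H g × SameOrbit N (g ⟨$⟩ʳ U) U'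

QArcTransitive : ∀ {n} → PermSet n → Digraph n → PermSet n → ℕ → Set
QArcTransitive H Γ N s = ∀ f f' → SArc (QArc Γ N) s f → SArc (QArc Γ N) s f' →
  ∃ λ g → H g × (∀ i → SameOrbit N (g ⟨$⟩ʳ f i) (f' i))

-- The orbits of a normal subgroup N are blocks, so s-arcs of Γ_N lift to s-arcs of Γ and
-- s-arc-transitivity of G passes to Γ_N.  A loop of Γ_N, moved around by arc-transitivity,
-- would keep every arc inside one N-orbit, so by connectivity there would be one orbit.
-- A pair of opposite arcs of Γ_N gives a 2-arc a → b → e with a ∼ e; by 2-arc-transitivity
-- every 2-arc then returns to its initial orbit, so all successors (and all predecessors)
-- of an N-orbit lie in a single orbit and the orbits of a and b cover Γ.  Both contradict
-- |V_N| ≥ 3.  For (b) it remains to see that a vertex-transitive M ⊴ G is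
-- (s-1)-arc-transitive: the powers of some m ∈ M trace an s-arc, and conjugating m by the
-- element of G carrying it onto any s-arc yields an element of M sending the initial
-- (s-1)-subarc to the final one.  Prepending predecessors then links any two (s-1)-arcs
-- with the same start, and connectivity links all of them.
module Submission where

open import Defs
open import Data.Nat using (ℕ; zero; suc; _≤_; _≤′_; ≤′-refl; ≤′-step; _∸_; _+_; s≤s)
open import Data.Nat.Properties using (≤⇒≤′; +-suc; m+1+n≰m)
open import Data.Fin using (Fin; zero; suc; inject₁; toℕ)
open import Data.Fin.Properties using (toℕ-inject₁; toℕ≤pred[n])
open import Data.Fin.Permutation using (_⟨$⟩ʳ_; _∘ₚ_; flip; id; inverseˡ)
open import Data.Vec.Functional using (Vector; []; _∷_; head; tail; init)
open import Data.Product using (∃; ∃₂; _×_; _,_; proj₁)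
open import Data.Sum using (_⊎_; inj₁; inj₂)
open import Data.Empty using (⊥-elim)
open import Function using (_∘_)
open import Relation.Nullary using (¬_)
open import Relation.Binary.PropositionalEquality
  using (_≡_; _≢_; refl; sym; trans; cong; subst; subst₂; module ≡-Reasoning)
open import Relation.Binary.Construct.Closure.ReflexiveTransitive using (ε; _◅_; fold; gmap)

private
  variable
    n s t : ℕ

_⊆Aut_ : PermSet n → Digraph n → Set
H ⊆Aut Γ = ∀ h → H h → IsAut Γ h

SameOrbitᵛ : ∀ {k} → PermSet n → Vector (Fin n) k → Vector (Fin n) k → Set
SameOrbitᵛ H α β = ∃ λ h → H h × (∀ i → h ⟨$⟩ʳ α i ≡ β i)

module _ {N : PermSet n} (N-sub : IsSubgroup N) where
  open IsSubgroup N-sub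

  orbit-refl : ∀ u → SameOrbit N u u
  orbit-refl u = id , one , refl

  orbit-member : ∀ {x} → N x → ∀ u → SameOrbit N u (x ⟨$⟩ʳ u)
  orbit-member {x} Nx u = x , Nx , refl

  orbit-sym : ∀ {u v} → SameOrbit N u v → SameOrbit N v u
  orbit-sym (x , Nx , xu≡v) = flip x , inv x Nx , trans (cong (flip x ⟨$⟩ʳ_) (sym xu≡v)) (inverseˡ x)

  orbit-trans : ∀ {u v w} → SameOrbit N u v → SameOrbit N v w → SameOrbit N u w
  orbit-trans (x , Nx , xu≡v) (y , Ny , yv≡w) =
    x ∘ₚ y , comp x y Nx Ny , trans (cong (y ⟨$⟩ʳ_) xu≡v) yv≡w

  orbitᵛ-refl : ∀ {k} (α : Vector (Fin n) k) → SameOrbitᵛ N α α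
  orbitᵛ-refl α = id , one , λ i → refl

  orbitᵛ-sym : ∀ {k} {α β : Vector (Fin n) k} → SameOrbitᵛ N α β → SameOrbitᵛ N β α
  orbitᵛ-sym (x , Nx , xα≡β) =
    flip x , inv x Nx , λ i → trans (cong (flip x ⟨$⟩ʳ_) (sym (xα≡β i))) (inverseˡ x)

  orbitᵛ-trans : ∀ {k} {α β γ : Vector (Fin n) k} →
                 SameOrbitᵛ N α β → SameOrbitᵛ N β γ → SameOrbitᵛ N α γ
  orbitᵛ-trans (x , Nx , xα≡β) (y , Ny , yβ≡γ) =
    x ∘ₚ y , comp x y Nx Ny , λ i → trans (cong (y ⟨$⟩ʳ_) (xα≡β i)) (yβ≡γ i)

  orbits-not-covered-by-two : AtLeast3Orbits N →
    ∀ a b → ¬ (∀ v → SameOrbit N a v ⊎ SameOrbit N b v)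
  orbits-not-covered-by-two (p , q , r , p≁q , p≁r , q≁r) a b cover
    with cover p | cover q | cover r
  ... | inj₁ ap | inj₁ aq | _       = p≁q (orbit-trans (orbit-sym ap) aq)
  ... | inj₂ bp | inj₂ bq | _       = p≁q (orbit-trans (orbit-sym bp) bq)
  ... | inj₁ ap | inj₂ _  | inj₁ ar = p≁r (orbit-trans (orbit-sym ap) ar)
  ... | inj₁ _  | inj₂ bq | inj₂ br = q≁r (orbit-trans (orbit-sym bq) br)
  ... | inj₂ bp | inj₁ _  | inj₂ br = p≁r (orbit-trans (orbit-sym bp) br)
  ... | inj₂ _  | inj₁ aq | inj₁ ar = q≁r (orbit-trans (orbit-sym aq) ar)

normal⇒orbit-preserving : ∀ {N H : PermSet n} → Normal N H → ∀ {h} → H h →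
  ∀ {u v} → SameOrbit N u v → SameOrbit N (h ⟨$⟩ʳ u) (h ⟨$⟩ʳ v)
normal⇒orbit-preserving N◁H {h} Hh (x , Nx , xu≡v) =
  conj h x , N◁H h x Hh Nx ,
  trans (cong (λ z → h ⟨$⟩ʳ (x ⟨$⟩ʳ z)) (inverseˡ h)) (cong (h ⟨$⟩ʳ_) xu≡v)

connected-invariant : ∀ {R : Fin n → Fin n → Set} {P : Fin n → Set} → Connected R →
  (∀ {x y} → R x y → P x → P y) → (∀ {x y} → R x y → P y → P x) →
  ∀ {u} v → P u → P v
connected-invariant {R = R} {P} conn forward backward {u} v =
  fold (λ x y → P x → P y) (λ r k → k ∘ step r) (λ p → p) (conn u v)
  where
  step : ∀ {x y} → R x y ⊎ R y x → P x → P y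
  step (inj₁ r) = forward r
  step (inj₂ r) = backward r

connected-arc : ∀ {R : Fin n → Fin n → Set} → Connected R → ∀ {u v} → u ≢ v → ∃₂ R
connected-arc conn {u} {v} u≢v with conn u v
... | ε          = ⊥-elim (u≢v refl)
... | inj₁ r ◅ _ = _ , _ , r
... | inj₂ r ◅ _ = _ , _ , r

quotient-connected : ∀ {Γ : Digraph n} {N} → IsSubgroup N → Connected (Arc Γ) → Connected (QArc Γ N)
quotient-connected {Γ = Γ} {N} N-sub conn u v = gmap (λ x → x) lift-step (conn u v)
  where
  lift-step : ∀ {x y} → Arc Γ x y ⊎ Arc Γ y x → QArc Γ N x y ⊎ QArc Γ N y x
  lift-step (inj₁ r) = inj₁ (_ , _ , orbit-refl N-sub _ , orbit-refl N-sub _ , r)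
  lift-step (inj₂ r) = inj₂ (_ , _ , orbit-refl N-sub _ , orbit-refl N-sub _ , r)

record Neighbours (Γ : Digraph n) : Set where
  field
    next prev : Fin n → Fin n
    next-arc  : ∀ v → Arc Γ v (next v)
    prev-arc  : ∀ v → Arc Γ (prev v) v

vertexTransitive⇒neighbours : ∀ {Γ : Digraph n} {H} → H ⊆Aut Γ → VertexTransitive H →
  ∀ {a b} → Arc Γ a b → Neighbours Γ
vertexTransitive⇒neighbours {Γ = Γ} H-aut vt {a} {b} ab = record
  { next = λ v → proj₁ (vt a v) ⟨$⟩ʳ b ; prev = λ v → proj₁ (vt b v) ⟨$⟩ʳ a
  ; next-arc = next-arc ; prev-arc = prev-arc }
  where
  next-arc : ∀ v → Arc Γ v (proj₁ (vt a v) ⟨$⟩ʳ b)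
  next-arc v with vt a v
  ... | h , Hh , ha≡v = subst (λ w → Arc Γ w (h ⟨$⟩ʳ b)) ha≡v (proj₁ (H-aut h Hh _ _) ab)
  prev-arc : ∀ v → Arc Γ (proj₁ (vt b v) ⟨$⟩ʳ a) v
  prev-arc v with vt b v
  ... | h , Hh , hb≡v = subst (Arc Γ (h ⟨$⟩ʳ a)) hb≡v (proj₁ (H-aut h Hh _ _) ab)

iterate : ∀ {k} {A : Set} → (A → A) → A → Vector A k
iterate f x zero    = x
iterate f x (suc i) = iterate f (f x) i

iterate-suc : ∀ {A : Set} (f : A → A) x (i : Fin s) →
  f (iterate f x (inject₁ i)) ≡ iterate f x (suc i)
iterate-suc f x zero    = refl
iterate-suc f x (suc i) = iterate-suc f (f x) i

module SArcs (R : Fin n → Fin n → Set) where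

  ∷-sarc : ∀ {x} {α : Vector (Fin n) (suc s)} → R x (head α) → SArc R s α → SArc R (suc s) (x ∷ α)
  ∷-sarc r sα zero    = r
  ∷-sarc r sα (suc i) = sα i

  init-sarc : ∀ {α : Vector (Fin n) (suc (suc s))} → SArc R (suc s) α → SArc R s (init α)
  init-sarc sα = sα ∘ inject₁

  iterate-sarc : ∀ (f : Fin n → Fin n) → (∀ {y} → R y (f y) → R (f y) (f (f y))) →
    ∀ {x} → R x (f x) → SArc R s (iterate f x)
  iterate-sarc f step r zero    = r
  iterate-sarc f step r (suc i) = iterate-sarc f step (step r) i

  sarc₁ : ∀ {x y} → R x y → SArc R 1 (x ∷ y ∷ [])
  sarc₁ r zero = r

  sarc₂ : ∀ {x y z} → R x y → R y z → SArc R 2 (x ∷ y ∷ z ∷ [])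
  sarc₂ r r′ = ∷-sarc r (sarc₁ r′)

conjugate-shifts : ∀ {k} m g (ρ γ : Vector (Fin n) (suc k)) → (∀ i → g ⟨$⟩ʳ ρ i ≡ γ i) →
  (∀ i → m ⟨$⟩ʳ ρ (inject₁ i) ≡ ρ (suc i)) → ∀ i → conj g m ⟨$⟩ʳ γ (inject₁ i) ≡ γ (suc i)
conjugate-shifts m g ρ γ gρ≡γ mρ≡ρ′ i = begin
  g ⟨$⟩ʳ (m ⟨$⟩ʳ (flip g ⟨$⟩ʳ γ (inject₁ i)))
    ≡⟨ cong (λ w → g ⟨$⟩ʳ (m ⟨$⟩ʳ (flip g ⟨$⟩ʳ w))) (sym (gρ≡γ (inject₁ i))) ⟩
  g ⟨$⟩ʳ (m ⟨$⟩ʳ (flip g ⟨$⟩ʳ (g ⟨$⟩ʳ ρ (inject₁ i))))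
    ≡⟨ cong (λ w → g ⟨$⟩ʳ (m ⟨$⟩ʳ w)) (inverseˡ g) ⟩
  g ⟨$⟩ʳ (m ⟨$⟩ʳ ρ (inject₁ i))
    ≡⟨ cong (g ⟨$⟩ʳ_) (mρ≡ρ′ i) ⟩
  g ⟨$⟩ʳ ρ (suc i)
    ≡⟨ gρ≡γ (suc i) ⟩
  γ (suc i) ∎
  where open ≡-Reasoning

module _ {Γ : Digraph n} {H : PermSet n} (nb : Neighbours Γ) where
  open Neighbours nb
  open SArcs (Arc Γ)

  arcTransitive-pred : ArcTransitive H Γ (suc s) → ArcTransitive H Γ s
  arcTransitive-pred at α β sα sβ
    with at (prev (head α) ∷ α) (prev (head β) ∷ β) (∷-sarc (prev-arc _) sα) (∷-sarc (prev-arc _) sβ)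
  ... | h , Hh , hα≡β = h , Hh , hα≡β ∘ suc

  arcTransitive-≤′ : s ≤′ t → ArcTransitive H Γ t → ArcTransitive H Γ s
  arcTransitive-≤′ ≤′-refl      at = at
  arcTransitive-≤′ (≤′-step s≤t) at = arcTransitive-≤′ s≤t (arcTransitive-pred at)

  arcTransitive-≤ : s ≤ t → ArcTransitive H Γ t → ArcTransitive H Γ s
  arcTransitive-≤ = arcTransitive-≤′ ∘ ≤⇒≤′

module _ {Γ : Digraph n} {N : PermSet n} (N-sub : IsSubgroup N) (N-aut : N ⊆Aut Γ) where
  open SArcs (Arc Γ)

  lift-sarc : ∀ s (f : Vector (Fin n) (suc s)) → SArc (QArc Γ N) s f →
    ∀ {x} → SameOrbit N (head f) x →
    ∃ λ l → SArc (Arc Γ) s l × (∀ i → SameOrbit N (f i) (l i)) × head l ≡ x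
  lift-sarc zero    f _  {x} f₀∼x = (λ _ → x) , (λ ()) , (λ { zero → f₀∼x }) , refl
  lift-sarc (suc s) f sf {x} f₀∼x with sf zero
  ... | u , u′ , f₀∼u , f₁∼u′ , uu′ with orbit-trans N-sub (orbit-sym N-sub f₀∼u) f₀∼x
  ... | z , Nz , zu≡x
    with lift-sarc s (tail f) (sf ∘ suc) (orbit-trans N-sub f₁∼u′ (orbit-member N-sub Nz u′))
  ... | l , sl , fl , l₀≡zu′ =
    x ∷ l , ∷-sarc x→l₀ sl , (λ { zero → f₀∼x ; (suc i) → fl i }) , refl
    where
    x→l₀ : Arc Γ x (head l)
    x→l₀ = subst₂ (Arc Γ) zu≡x (sym l₀≡zu′) (proj₁ (N-aut z Nz _ _) uu′)

  quotient-arcTransitive : ∀ {H K} → Normal N H → (∀ h → H h → K h) →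
    ArcTransitive H Γ s → QArcTransitive K Γ N s
  quotient-arcTransitive N◁H H⊆K at f f′ sf sf′
    with lift-sarc _ f sf (orbit-refl N-sub _) | lift-sarc _ f′ sf′ (orbit-refl N-sub _)
  ... | l , sl , fl , _ | l′ , sl′ , fl′ , _ with at l l′ sl sl′
  ... | h , Hh , hl≡l′ = h , H⊆K h Hh , λ i →
    orbit-trans N-sub (subst (SameOrbit N _) (hl≡l′ i) (normal⇒orbit-preserving N◁H Hh (fl i)))
                      (orbit-sym N-sub (fl′ i))

quotient-vertexTransitive : ∀ {N H K : PermSet n} → IsSubgroup N → (∀ h → H h → K h) →
  VertexTransitive H → QVertexTransitive K N
quotient-vertexTransitive N-sub H⊆K vt U U′ with vt U U′
... | h , Hh , hU≡U′ = h , H⊆K h Hh , subst (SameOrbit _ _) hU≡U′ (orbit-refl N-sub _)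

module TwoArcsClose {Γ : Digraph n} {N : PermSet n} (N-sub : IsSubgroup N) (N-aut : N ⊆Aut Γ)
  (nb : Neighbours Γ) (closes : ∀ {p q r} → Arc Γ p q → Arc Γ q r → SameOrbit N p r) where
  open Neighbours nb

  successor-orbit : ∀ {p p′ q q′} → SameOrbit N p p′ → Arc Γ p q → Arc Γ p′ q′ → SameOrbit N q q′
  successor-orbit {p′ = p′} {q} (y , Ny , yp≡p′) pq p′q′ =
    orbit-trans N-sub (orbit-member N-sub Ny _)
      (orbit-trans N-sub (orbit-sym N-sub (closes (prev-arc _) p′yq)) (closes (prev-arc _) p′q′))
    where
    p′yq : Arc Γ p′ (y ⟨$⟩ʳ q)
    p′yq = subst (λ w → Arc Γ w _) yp≡p′ (proj₁ (N-aut y Ny _ _) pq)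

  predecessor-orbit : ∀ {p p′ q q′} → SameOrbit N q q′ → Arc Γ p q → Arc Γ p′ q′ → SameOrbit N p p′
  predecessor-orbit {p} {q′ = q′} (y , Ny , yq≡q′) pq p′q′ =
    orbit-trans N-sub (orbit-member N-sub Ny _)
      (orbit-trans N-sub (closes ypq′ (next-arc _)) (orbit-sym N-sub (closes p′q′ (next-arc _))))
    where
    ypq′ : Arc Γ (y ⟨$⟩ʳ p) q′
    ypq′ = subst (Arc Γ _) yq≡q′ (proj₁ (N-aut y Ny _ _) pq)

  two-orbits-cover : ∀ {a b e} → Connected (Arc Γ) → Arc Γ a b → Arc Γ b e → SameOrbit N a e →
    ∀ v → SameOrbit N a v ⊎ SameOrbit N b v
  two-orbits-cover {a} {b} {e} conn ab be a∼e v =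
    connected-invariant conn forward backward v (inj₁ (orbit-refl N-sub a))
    where
    P : Fin n → Set
    P v = SameOrbit N a v ⊎ SameOrbit N b v
    forward : ∀ {v w} → Arc Γ v w → P v → P w
    forward vw (inj₁ a∼v) = inj₂ (successor-orbit a∼v ab vw)
    forward vw (inj₂ b∼v) = inj₁ (orbit-trans N-sub a∼e (successor-orbit b∼v be vw))
    backward : ∀ {w v} → Arc Γ w v → P v → P w
    backward wv (inj₁ a∼v) = inj₂ (predecessor-orbit (orbit-trans N-sub (orbit-sym N-sub a∼e) a∼v) be wv)
    backward wv (inj₂ b∼v) = inj₁ (predecessor-orbit b∼v ab wv)

module _ {Γ : Digraph n} {N H : PermSet n} (N-sub : IsSubgroup N) (N-aut : N ⊆Aut Γ) (N◁H : Normal N H)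
         (conn : Connected (Arc Γ)) (three : AtLeast3Orbits N) where
  open SArcs (Arc Γ)

  arcTransitive-transfers-orbits : ArcTransitive H Γ s → ∀ α β → SArc (Arc Γ) s α → SArc (Arc Γ) s β →
    ∀ i j → SameOrbit N (α i) (α j) → SameOrbit N (β i) (β j)
  arcTransitive-transfers-orbits at α β sα sβ i j αi∼αj with at α β sα sβ
  ... | h , Hh , hα≡β = subst₂ (SameOrbit N) (hα≡β i) (hα≡β j) (normal⇒orbit-preserving N◁H Hh αi∼αj)

  quotient-loopless : ArcTransitive H Γ 1 → ∀ U U′ → SameOrbit N U U′ → ¬ QArc Γ N U U′
  quotient-loopless at U U′ U∼U′ (u , u′ , U∼u , U′∼u′ , uu′) =
    orbits-not-covered-by-two N-sub three u u (inj₁ ∘ orbit-of-u)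
    where
    u∼u′ : SameOrbit N u u′
    u∼u′ = orbit-trans N-sub (orbit-sym N-sub U∼u) (orbit-trans N-sub U∼U′ U′∼u′)
    arc-within-orbit : ∀ {x y} → Arc Γ x y → SameOrbit N x y
    arc-within-orbit {x} {y} xy = arcTransitive-transfers-orbits at
      (u ∷ u′ ∷ []) (x ∷ y ∷ []) (sarc₁ uu′) (sarc₁ xy) zero (suc zero) u∼u′
    orbit-of-u : ∀ v → SameOrbit N u v
    orbit-of-u v = connected-invariant conn
      (λ xy u∼x → orbit-trans N-sub u∼x (arc-within-orbit xy))
      (λ xy u∼y → orbit-trans N-sub u∼y (orbit-sym N-sub (arc-within-orbit xy)))
      v (orbit-refl N-sub u)

  quotient-asymmetric : Neighbours Γ → ArcTransitive H Γ 2 → ∀ U U′ → QArc Γ N U U′ → ¬ QArc Γ N U′ U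
  quotient-asymmetric nb at U U′ (a , b , U∼a , U′∼b , ab) (c , d , U′∼c , U∼d , cd)
    with orbit-trans N-sub (orbit-sym N-sub U′∼c) U′∼b
  ... | y , Ny , yc≡b = orbits-not-covered-by-two N-sub three a b (two-orbits-cover conn ab be a∼e)
    where
    e : Fin n
    e = y ⟨$⟩ʳ d
    be : Arc Γ b e
    be = subst (λ w → Arc Γ w e) yc≡b (proj₁ (N-aut y Ny _ _) cd)
    a∼e : SameOrbit N a e
    a∼e = orbit-trans N-sub (orbit-sym N-sub U∼a) (orbit-trans N-sub U∼d (orbit-member N-sub Ny d))
    closes : ∀ {p q r} → Arc Γ p q → Arc Γ q r → SameOrbit N p r
    closes {p} {q} {r} pq qr = arcTransitive-transfers-orbits at
      (a ∷ b ∷ e ∷ []) (p ∷ q ∷ r ∷ []) (sarc₂ ab be) (sarc₂ pq qr) zero (suc (suc zero)) a∼e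
    open TwoArcsClose N-sub N-aut nb closes

  quotient-isDigraph : Neighbours Γ → ArcTransitive H Γ 2 → QIsDigraph Γ N
  quotient-isDigraph nb at = quotient-loopless (arcTransitive-pred nb at) , quotient-asymmetric nb at

module VertexTransitiveNormalSubgroup {Γ : Digraph n} {G M : PermSet n} {t : ℕ}
  (G-aut : G ⊆Aut Γ) (M-sub : IsSubgroup M) (M⊆G : ∀ m → M m → G m) (M◁G : Normal M G)
  (M-vt : VertexTransitive M) (nb : Neighbours Γ) (G-at : ArcTransitive G Γ (suc t)) where
  open Neighbours nb
  open SArcs (Arc Γ)

  _≈_ : Vector (Fin n) (suc t) → Vector (Fin n) (suc t) → Set
  _≈_ = SameOrbitᵛ M

  init≈tail : ∀ γ → SArc (Arc Γ) (suc t) γ → init γ ≈ tail γ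
  init≈tail γ sγ with M-vt (head γ) (next (head γ))
  ... | m , Mm , mγ₀≡next
    with G-at (iterate (m ⟨$⟩ʳ_) (head γ)) γ
           (iterate-sarc _ (proj₁ (G-aut m (M⊆G m Mm) _ _))
                         (subst (Arc Γ _) (sym mγ₀≡next) (next-arc _))) sγ
  ... | g , Gg , gρ≡γ =
    conj g m , M◁G g m Gg Mm , conjugate-shifts m g _ γ gρ≡γ (iterate-suc (m ⟨$⟩ʳ_) (head γ))

  retreat : Vector (Fin n) (suc t) → Vector (Fin n) (suc t)
  retreat α = init (prev (head α) ∷ α)

  retreat-sarc : ∀ {α} → SArc (Arc Γ) t α → SArc (Arc Γ) t (retreat α)
  retreat-sarc {α} sα = init-sarc {α = prev (head α) ∷ α} (∷-sarc (prev-arc _) sα)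

  retreat≈ : ∀ {α} → SArc (Arc Γ) t α → retreat α ≈ α
  retreat≈ {α} sα = init≈tail (prev (head α) ∷ α) (∷-sarc (prev-arc _) sα)

  AgreeExceptLast : ℕ → Vector (Fin n) (suc t) → Vector (Fin n) (suc t) → Set
  AgreeExceptLast j α β = ∀ i → j + toℕ i ≤ t → α i ≡ β i

  retreat-agrees : ∀ {j α β} → head α ≡ head β → AgreeExceptLast (suc j) α β →
    AgreeExceptLast j (retreat α) (retreat β)
  retreat-agrees α₀≡β₀ agree zero    _        = cong prev α₀≡β₀
  retreat-agrees {j} α₀≡β₀ agree (suc i) j+1+i≤t = agree (inject₁ i) (subst (_≤ t) index-shift j+1+i≤t)
    where
    index-shift : j + suc (toℕ i) ≡ suc j + toℕ (inject₁ i)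
    index-shift = trans (+-suc j (toℕ i)) (cong (λ k → suc (j + k)) (sym (toℕ-inject₁ i)))

  agreeing⇒≈ : ∀ j {α β} → SArc (Arc Γ) t α → SArc (Arc Γ) t β → head α ≡ head β →
    AgreeExceptLast j α β → α ≈ β
  agreeing⇒≈ zero    sα sβ _     agree = id , IsSubgroup.one M-sub , λ i → agree i (toℕ≤pred[n] i)
  agreeing⇒≈ (suc j) sα sβ α₀≡β₀ agree = orbitᵛ-trans M-sub (orbitᵛ-sym M-sub (retreat≈ sα))
    (orbitᵛ-trans M-sub (agreeing⇒≈ j (retreat-sarc sα) (retreat-sarc sβ) (cong prev α₀≡β₀)
                                    (retreat-agrees α₀≡β₀ agree))
                        (retreat≈ sβ))

  same-head⇒≈ : ∀ {α β} → SArc (Arc Γ) t α → SArc (Arc Γ) t β → head α ≡ head β → α ≈ β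
  same-head⇒≈ sα sβ α₀≡β₀ = agreeing⇒≈ t sα sβ α₀≡β₀ λ
    { zero    _         → α₀≡β₀
    ; (suc i) t+1+i≤t → ⊥-elim (m+1+n≰m t t+1+i≤t) }

  walk : Fin n → Vector (Fin n) (suc t)
  walk = iterate next

  walk-sarc : ∀ x → SArc (Arc Γ) t (walk x)
  walk-sarc x = iterate-sarc next (λ _ → next-arc _) (next-arc x)

  walk≈walk : ∀ {x z} → Arc Γ x z → walk x ≈ walk z
  walk≈walk {x} {z} xz = orbitᵛ-trans M-sub
    (same-head⇒≈ (walk-sarc x) (init-sarc {α = x ∷ walk z} xwalk-sarc) refl)
    (init≈tail (x ∷ walk z) xwalk-sarc)
    where
    xwalk-sarc : SArc (Arc Γ) (suc t) (x ∷ walk z)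
    xwalk-sarc = ∷-sarc xz (walk-sarc z)

  arcTransitive : Connected (Arc Γ) → ArcTransitive M Γ t
  arcTransitive conn α β sα sβ =
    orbitᵛ-trans M-sub (same-head⇒≈ sα (walk-sarc _) refl)
      (orbitᵛ-trans M-sub walks≈ (orbitᵛ-sym M-sub (same-head⇒≈ sβ (walk-sarc _) refl)))
    where
    walks≈ : walk (head α) ≈ walk (head β)
    walks≈ = connected-invariant conn
      (λ xz r → orbitᵛ-trans M-sub r (walk≈walk xz))
      (λ zx r → orbitᵛ-trans M-sub r (orbitᵛ-sym M-sub (walk≈walk zx)))
      (head β) (orbitᵛ-refl M-sub _)

quotient-by-normal : ∀ {Γ : Digraph n} {G N : PermSet n} → G ⊆Aut Γ → Connected (Arc Γ) →
  VertexTransitive G → ArcTransitive G Γ s → Neighbours Γ → N ≤G G → Normal N G →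
  AtLeast3Orbits N → 2 ≤ s →
  QIsDigraph Γ N × QVertexTransitive G N × QArcTransitive G Γ N s
quotient-by-normal {Γ = Γ} {N = N} G-aut conn G-vt G-at nb (N-sub , N⊆G) N◁G three 2≤s =
  quotient-isDigraph N-sub N-aut N◁G conn three nb (arcTransitive-≤ nb 2≤s G-at) ,
  quotient-vertexTransitive N-sub (λ _ Gg → Gg) G-vt ,
  quotient-arcTransitive {Γ = Γ} N-sub N-aut N◁G (λ _ Gg → Gg) G-at
  where
  N-aut : N ⊆Aut Γ
  N-aut h Nh = G-aut h (N⊆G h Nh)

normal⇒⊆normaliser : ∀ {G N M : PermSet n} → M ≤G G → Normal N M → ∀ m → M m → Normaliser G N m
normal⇒⊆normaliser (M-sub , M⊆G) N◁M m Mm =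
  M⊆G m Mm , (λ h → N◁M m h Mm) , (λ h → N◁M (flip m) h (IsSubgroup.inv M-sub m Mm))

quotient-by-subnormal : ∀ {Γ : Digraph n} {G N M : PermSet n} → G ⊆Aut Γ → Connected (Arc Γ) →
  ArcTransitive G Γ s → Neighbours Γ → N ≤G M → M ≤G G → Normal N M → Normal M G →
  VertexTransitive M → AtLeast3Orbits N → 3 ≤ s →
  QIsDigraph Γ N × QVertexTransitive (Normaliser G N) N × QArcTransitive (Normaliser G N) Γ N (s ∸ 1)
quotient-by-subnormal {s = suc t} {Γ} {G} {N} {M} G-aut conn G-at nb (N-sub , N⊆M) M≤G@(M-sub , M⊆G)
  N◁M M◁G M-vt three (s≤s 2≤t) =
  quotient-isDigraph N-sub N-aut N◁M conn three nb (arcTransitive-≤ nb 2≤t M-at) ,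
  quotient-vertexTransitive N-sub (normal⇒⊆normaliser M≤G N◁M) M-vt ,
  quotient-arcTransitive {Γ = Γ} N-sub N-aut N◁M (normal⇒⊆normaliser M≤G N◁M) M-at
  where
  N-aut : N ⊆Aut Γ
  N-aut h Nh = G-aut h (M⊆G h (N⊆M h Nh))
  M-at : ArcTransitive M Γ t
  M-at = VertexTransitiveNormalSubgroup.arcTransitive G-aut M-sub M⊆G M◁G M-vt nb G-at conn

proposition2p2 : ∀ {n : ℕ} (Γ : Digraph n) (G N : PermSet n) (s : ℕ) →
    IsAutGroup Γ G → Connected (Arc Γ) → VertexTransitive G →
    1 ≤ s → ArcTransitive G Γ s →
    N ≤G G → AtLeast3Orbits N →
    Connected (QArc Γ N)
    × (Normal N G → 2 ≤ s →
         QIsDigraph Γ N × QVertexTransitive G N × QArcTransitive G Γ N s)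
    × ((M : PermSet n) → N ≤G M → M ≤G G → Normal N M → Normal M G →
         3 ≤ s → ¬ Normal N G → VertexTransitive M →
         QIsDigraph Γ N × QVertexTransitive (Normaliser G N) N
           × QArcTransitive (Normaliser G N) Γ N (s ∸ 1))
proposition2p2 Γ G N s (_ , G-aut) conn G-vt _ G-at N≤G@(N-sub , _) three@(p , q , _ , p≁q , _) =
  quotient-connected {Γ = Γ} N-sub conn ,
  (λ N◁G → quotient-by-normal G-aut conn G-vt G-at nb N≤G N◁G three) ,
  (λ M N≤M M≤G N◁M M◁G 3≤s _ M-vt →
     quotient-by-subnormal G-aut conn G-at nb N≤M M≤G N◁M M◁G M-vt three 3≤s)
  where
  p≢q : p ≢ q
  p≢q refl = p≁q (orbit-refl N-sub p)
  nb : Neighbours Γ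
  nb with connected-arc conn p≢q
  ... | _ , _ , ab = vertexTransitive⇒neighbours G-aut G-vt ab
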